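{- Let $M$ be a median graph and let $k$ be its lattice dimension. Then there is an isometric embedding $\phi$ of $M$ into a $k$-lattice $L=P^1\,\Box\cdots\Box\,P^k$ (each $P^j$ a path) such that for every $j=1,\ldots,k$ and every vertex $u_j\in V(P^j)$, we have $\pi_j^{ -1}(u_j)\cap \phi(V(M))\neq\emptyset$, where $\pi_j:V(L)\to V(P^j)$ is the projection onto the $j$-th coordinate.
   Context: All graphs are finite, undirected and simple. For vertices $u,v$ of a connected graph, $I(u,v)$ is the set of vertices lying on some shortest $(u,v)$-path. A connected graph $M$ is a median graph if for any three vertices $u,v,w$ we have $|I(u,v)\cap I(v,w)\cap I(w,u)|=1$. The Cartesian product $G\Box H$ has vertex set $V(G)\times V(H)$, with $(a,x)(b,y)$ an edge iff ($ab\in E(G)$ and $x=y$) or ($a=b$ and $xy\in E(H)$). A $k$-lattice is a Cartesian product of $k$ paths. A map $\phi:V(H)\to V(G)$ is an isometric embedding if $d_G(\phi(u),\phi(v))=d_H(u,v)$ for all $u,v\in V(H)$. The lattice dimension of a median graph $M$ is the minimum $k$ such that $M$ isometrically embeds into a $k$-lattice. -}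

module Defs where

open import Level using (0ℓ)
open import Data.Nat using (ℕ; zero; suc; _+_; _≤_)
open import Data.Fin using (Fin; toℕ)
open import Data.Unit using (⊤)
open import Data.Empty using (⊥)
open import Data.Product using (Σ; ∃; _×_; _,_)
open import Data.Sum using (_⊎_)
open import Relation.Nullary using (¬_)
open import Relation.Binary.PropositionalEquality using (_≡_)
open import Function.Bundles using (_↔_)

record Graph : Set₁ where
  field
    V     : Set
    E     : V → V → Set
    sym   : ∀ {u v} → E u v → E v u
    irrefl : ∀ {u} → ¬ E u u
open Graph public

data Walk (G : Graph) : V G → V G → ℕ → Set where
  nil  : ∀ {u} → Walk G u u 0
  cons : ∀ {u v w ℓ} → E G u v → Walk G v w ℓ → Walk G u w (suc ℓ)

Dist : (G : Graph) → V G → V G → ℕ → Set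
Dist G u v d = Walk G u v d × (∀ d' → Walk G u v d' → d ≤ d')

Connected : Graph → Set
Connected G = ∀ u v → ∃ λ d → Walk G u v d

-- x ∈ I(u,v): x lies on some shortest (u,v)-walk, i.e. a shortest walk
-- is the concatenation of a (u,x)-walk and an (x,v)-walk.
InInterval : (G : Graph) → V G → V G → V G → Set
InInterval G u v x =
  ∃ λ a → ∃ λ b → Walk G u x a × Walk G x v b × Dist G u v (a + b)

IsMedian : Graph → Set
IsMedian G =
  Connected G ×
  (∀ u v w → Σ (V G) λ x →
     (InInterval G u v x × InInterval G v w x × InInterval G w u x) ×
     (∀ y → InInterval G u v y → InInterval G v w y → InInterval G w u y → y ≡ x))

IsFinite : Graph → Set
IsFinite G = Σ ℕ λ n → V G ↔ Fin n

-- Path on m+1 vertices 0 - 1 - ... - m.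
PathGraph : ℕ → Graph
PathGraph m = record
  { V = Fin (suc m)
  ; E = λ a b → suc (toℕ a) ≡ toℕ b ⊎ suc (toℕ b) ≡ toℕ a
  ; sym = λ { (Data.Sum.inj₁ p) → Data.Sum.inj₂ p ; (Data.Sum.inj₂ p) → Data.Sum.inj₁ p }
  ; irrefl = irr
  }
  where
  open import Data.Nat.Properties using (1+n≢n)
  irr : ∀ {u} → ¬ (suc (toℕ u) ≡ toℕ u ⊎ suc (toℕ u) ≡ toℕ u)
  irr {u} (Data.Sum.inj₁ p) = 1+n≢n p
  irr {u} (Data.Sum.inj₂ p) = 1+n≢n p

-- One-vertex graph K1 (the empty Cartesian product).
K1 : Graph
K1 = record { V = ⊤ ; E = λ _ _ → ⊥ ; sym = λ () ; irrefl = λ () }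

ProdE : (G H : Graph) → V G × V H → V G × V H → Set
ProdE G H (a , x) (b , y) = (E G a b × x ≡ y) ⊎ (a ≡ b × E H x y)

ProdE-sym : (G H : Graph) → ∀ {p q} → ProdE G H p q → ProdE G H q p
ProdE-sym G H (Data.Sum.inj₁ (e , q)) = Data.Sum.inj₁ (Graph.sym G e , Eq.sym q)
  where import Relation.Binary.PropositionalEquality as Eq
ProdE-sym G H (Data.Sum.inj₂ (q , e)) = Data.Sum.inj₂ (Eq.sym q , Graph.sym H e)
  where import Relation.Binary.PropositionalEquality as Eq

ProdE-irr : (G H : Graph) → ∀ {p} → ¬ ProdE G H p p
ProdE-irr G H (Data.Sum.inj₁ (e , _)) = irrefl G e
ProdE-irr G H (Data.Sum.inj₂ (_ , e)) = irrefl H e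

_□_ : Graph → Graph → Graph
G □ H = record
  { V = V G × V H
  ; E = ProdE G H
  ; sym = ProdE-sym G H
  ; irrefl = ProdE-irr G H
  }

-- k-lattice P^1 □ (P^2 □ ( ... □ (P^k □ K1))), where P^j is the path
-- with m j + 1 vertices.
Lattice : (k : ℕ) → (Fin k → ℕ) → Graph
Lattice zero    m = K1
Lattice (suc k) m = PathGraph (m Fin.zero) □ Lattice k (λ j → m (Fin.suc j))
  where import Data.Fin as Fin

proj : (k : ℕ) (m : Fin k → ℕ) (j : Fin k) → V (Lattice k m) → Fin (suc (m j))
proj (suc k) m Fin.zero    (a , _) = a
  where import Data.Fin as Fin
proj (suc k) m (Fin.suc j) (_ , x) = proj k (λ i → m (Fin.suc i)) j x
  where import Data.Fin as Fin

IsIsometricEmbedding : (H G : Graph) → (V H → V G) → Set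
IsIsometricEmbedding H G φ =
  ∀ u v d → (Dist H u v d → Dist G (φ u) (φ v) d) × (Dist G (φ u) (φ v) d → Dist H u v d)

EmbedsInLattice : Graph → ℕ → Set
EmbedsInLattice M k =
  Σ (Fin k → ℕ) λ m → Σ (V M → V (Lattice k m)) λ φ → IsIsometricEmbedding M (Lattice k m) φ

IsLatticeDimension : Graph → ℕ → Set
IsLatticeDimension M k = EmbedsInLattice M k × (∀ k' → EmbedsInLattice M k' → k ≤ k')

module Submission where

-- Start from any isometric embedding φ of M into a k-lattice with side
-- lengths m.  In coordinate j the values of φ range over an interval
-- [a j , a j + m' j] (M is finite and nonempty).  Shrinking every path to
-- that interval gives a smaller lattice L' and two coordinatewise maps:
-- the shift ι : L' → L, which preserves edges, and the clamp c ↦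
-- min (c ∸ a j , m' j) : L → L', which maps every edge to an edge or to a
-- single vertex and undoes ι.  Such a retraction forces ι to be isometric
-- (walks transported back by the clamp are never longer), and since φ
-- lands in the box, ψ := clamp ∘ φ satisfies ι ∘ ψ = φ, so ψ is isometric
-- too.  Finally every coordinate value of L' is hit: along a walk in M
-- from a vertex minimising coordinate j to one maximising it, the
-- coordinate changes by at most one per edge (a discrete intermediate
-- value theorem).  The median property is used only through
-- connectivity, and minimality of k only to rule out M being empty.

open import Defs hiding (sym)
open import Data.Nat using (ℕ; zero; suc; _+_; _∸_; _⊓_; _≤_; z≤n; s≤s; _≟_)
open import Data.Nat.Properties
open import Data.Fin using (Fin; toℕ; fromℕ<) renaming (zero to fz; suc to fs)
open import Data.Fin.Properties using (toℕ-fromℕ<; toℕ-injective; toℕ≤pred[n])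
open import Data.Vec.Functional using (tail)
open import Data.Product using (Σ; _×_; _,_; proj₁; proj₂)
open import Data.Sum using (_⊎_; inj₁; inj₂) renaming (map to ⊎-map)
open import Data.Unit using (tt)
open import Data.Empty using (⊥; ⊥-elim)
open import Data.List using (List; []; _∷_; map; allFin)
open import Data.List.Membership.Propositional using (_∈_)
open import Data.List.Membership.Propositional.Properties using (∈-map⁺; ∈-allFin)
open import Data.List.Relation.Unary.All using (lookup)
open import Data.List.Relation.Unary.Any.Properties using (¬Any[])
import Data.List.Extrema
open import Function.Bundles using (Inverse)
open import Relation.Nullary using (yes; no)
open import Relation.Binary.PropositionalEquality
  using (_≡_; refl; sym; trans; cong; cong₂; subst; subst₂; module ≡-Reasoning)

Homomorphism : (G H : Graph) → (V G → V H) → Set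
Homomorphism G H f = ∀ {u v} → E G u v → E H (f u) (f v)

Contraction : (G H : Graph) → (V G → V H) → Set
Contraction G H g = ∀ {u v} → E G u v → E H (g u) (g v) ⊎ g u ≡ g v

homomorphism-walk : ∀ {G H f} → Homomorphism G H f →
  ∀ {u v d} → Walk G u v d → Walk H (f u) (f v) d
homomorphism-walk hf nil        = nil
homomorphism-walk hf (cons e w) = cons (hf e) (homomorphism-walk hf w)

contraction-walk : ∀ {G H g} → Contraction G H g →
  ∀ {u v d} → Walk G u v d → Σ ℕ λ d' → d' ≤ d × Walk H (g u) (g v) d'
contraction-walk cg nil = 0 , z≤n , nil
contraction-walk {H = H} {g} cg {v = v} (cons e w) with contraction-walk cg w | cg e
... | d' , d'≤d , w' | inj₁ e' = suc d' , s≤s d'≤d , cons e' w'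
... | d' , d'≤d , w' | inj₂ eq =
  d' , m≤n⇒m≤1+n d'≤d , subst (λ x → Walk H x (g v) d') (sym eq) w'

-- A homomorphism admitting a contraction as left inverse is isometric:
-- shortest walks are carried forward, and any walk in H pulls back to a
-- walk in G that is no longer.
retract-isometric : ∀ {G H f g} → Homomorphism G H f → Contraction H G g →
  (∀ x → g (f x) ≡ x) → IsIsometricEmbedding G H f
retract-isometric {G} {H} {f} {g} hf cg gf u v d = forward , backward
  where
  pullback : ∀ {e} → Walk H (f u) (f v) e → Σ ℕ λ e' → e' ≤ e × Walk G u v e'
  pullback w with contraction-walk cg w
  ... | e' , e'≤e , w' = e' , e'≤e , subst₂ (λ x y → Walk G x y e') (gf u) (gf v) w'

  forward : Dist G u v d → Dist H (f u) (f v) d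
  forward (w , shortest) = homomorphism-walk hf w , λ e w' →
    let (e' , e'≤e , w'') = pullback w' in ≤-trans (shortest e' w'') e'≤e

  backward : Dist H (f u) (f v) d → Dist G u v d
  backward (w , shortest) with pullback w
  ... | e' , e'≤d , w' =
    subst (Walk G u v) (≤-antisym e'≤d (shortest e' (homomorphism-walk hf w'))) w' ,
    λ e w'' → shortest e (homomorphism-walk hf w'')

isometric-factor : ∀ {M L' L} (ψ : V M → V L') (ι : V L' → V L) (φ : V M → V L) →
  IsIsometricEmbedding L' L ι → IsIsometricEmbedding M L φ →
  (∀ x → ι (ψ x) ≡ φ x) → IsIsometricEmbedding M L' ψ
isometric-factor {L = L} ψ ι φ ι-iso φ-iso ιψ≡φ u v d =
  (λ D → proj₂ (ι-iso (ψ u) (ψ v) d) (toι (proj₁ (φ-iso u v d) D))) ,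
  (λ D → proj₂ (φ-iso u v d) (toφ (proj₁ (ι-iso (ψ u) (ψ v) d) D)))
  where
  toι : Dist L (φ u) (φ v) d → Dist L (ι (ψ u)) (ι (ψ v)) d
  toι = subst₂ (λ p q → Dist L p q d) (sym (ιψ≡φ u)) (sym (ιψ≡φ v))
  toφ : Dist L (ι (ψ u)) (ι (ψ v)) d → Dist L (φ u) (φ v) d
  toφ = subst₂ (λ p q → Dist L p q d) (ιψ≡φ u) (ιψ≡φ v)

edge-distance : ∀ {G u v} → E G u v → Dist G u v 1
edge-distance {G} {u} e = cons e nil , shortest
  where
  shortest : ∀ d → Walk G u _ d → 1 ≤ d
  shortest zero    nil = ⊥-elim (irrefl G e)
  shortest (suc d) _   = s≤s z≤n

isometric-homomorphism : ∀ {G H φ} → IsIsometricEmbedding G H φ → Homomorphism G H φ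
isometric-homomorphism iso {u} {v} e with proj₁ (proj₁ (iso u v 1) (edge-distance e))
... | cons e' nil = e'

intermediate-value : ∀ {G} (f : V G → ℕ) → (∀ {u v} → E G u v → f v ≤ suc (f u)) →
  ∀ {x y d} → Walk G x y d → ∀ t → f x ≤ t → t ≤ f y → Σ (V G) λ z → f z ≡ t
intermediate-value f step {x} nil t fx≤t t≤fy = x , ≤-antisym fx≤t t≤fy
intermediate-value f step {x} (cons e w) t fx≤t t≤fy with f x ≟ t
... | yes fx≡t = x , fx≡t
... | no  fx≢t = intermediate-value f step w t (≤-trans (step e) (≤∧≢⇒< fx≤t fx≢t)) t≤fy

homomorphism-□ : ∀ {G₁ H₁ G₂ H₂ f₁ f₂} →
  Homomorphism G₁ H₁ f₁ → Homomorphism G₂ H₂ f₂ →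
  Homomorphism (G₁ □ G₂) (H₁ □ H₂) (λ p → f₁ (proj₁ p) , f₂ (proj₂ p))
homomorphism-□ {f₂ = f₂} h₁ h₂ (inj₁ (e , q)) = inj₁ (h₁ e , cong f₂ q)
homomorphism-□ {f₁ = f₁} h₁ h₂ (inj₂ (q , e)) = inj₂ (cong f₁ q , h₂ e)

contraction-□ : ∀ {G₁ H₁ G₂ H₂ g₁ g₂} →
  Contraction G₁ H₁ g₁ → Contraction G₂ H₂ g₂ →
  Contraction (G₁ □ G₂) (H₁ □ H₂) (λ p → g₁ (proj₁ p) , g₂ (proj₂ p))
contraction-□ {g₂ = g₂} c₁ c₂ (inj₁ (e , q)) with c₁ e
... | inj₁ e' = inj₁ (inj₁ (e' , cong g₂ q))
... | inj₂ eq = inj₂ (cong₂ _,_ eq (cong g₂ q))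
contraction-□ {g₁ = g₁} c₁ c₂ (inj₂ (q , e)) with c₂ e
... | inj₁ e' = inj₁ (inj₂ (cong g₁ q , e'))
... | inj₂ eq = inj₂ (cong₂ _,_ (cong g₁ q) eq)

UnitStep : (ℕ → ℕ) → Set
UnitStep h = ∀ c → h (suc c) ≡ suc (h c) ⊎ h (suc c) ≡ h c

∸-unitStep : ∀ a → UnitStep (_∸ a)
∸-unitStep zero    c       = inj₁ refl
∸-unitStep (suc a) zero    = inj₂ (trans (0∸n≡0 a) (sym (0∸n≡0 (suc a))))
∸-unitStep (suc a) (suc c) = ∸-unitStep a c

⊓-unitStep : ∀ m → UnitStep (_⊓ m)
⊓-unitStep zero    zero    = inj₂ refl
⊓-unitStep zero    (suc c) = inj₂ refl
⊓-unitStep (suc m) zero    = inj₁ refl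
⊓-unitStep (suc m) (suc c) with ⊓-unitStep m c
... | inj₁ p = inj₁ (cong suc p)
... | inj₂ p = inj₂ (cong suc p)

unitStep-∘ : ∀ {g h} → UnitStep g → UnitStep h → UnitStep (λ c → g (h c))
unitStep-∘ {g} {h} gs hs c with hs c
... | inj₂ flat = inj₂ (cong g flat)
... | inj₁ up   = subst (λ t → g t ≡ suc (g (h c)) ⊎ g t ≡ g (h c)) (sym up) (gs (h c))

unitStep-image : ∀ {m m'} (F : Fin (suc m) → Fin (suc m')) (h : ℕ → ℕ) →
  (∀ c → toℕ (F c) ≡ h (toℕ c)) → UnitStep h →
  ∀ {x y} → suc (toℕ x) ≡ toℕ y → toℕ (F y) ≡ suc (toℕ (F x)) ⊎ toℕ (F y) ≡ toℕ (F x)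
unitStep-image F h F≗h hs {x} {y} x→y =
  ⊎-map (λ up → trans Fy≡h[1+x] (trans up (cong suc (sym (F≗h x)))))
        (λ flat → trans Fy≡h[1+x] (trans flat (sym (F≗h x))))
        (hs (toℕ x))
  where
  Fy≡h[1+x] : toℕ (F y) ≡ h (suc (toℕ x))
  Fy≡h[1+x] = trans (F≗h y) (cong h (sym x→y))

unitStep-contraction : ∀ {m m'} (F : Fin (suc m) → Fin (suc m')) (h : ℕ → ℕ) →
  (∀ c → toℕ (F c) ≡ h (toℕ c)) → UnitStep h → Contraction (PathGraph m) (PathGraph m') F
unitStep-contraction F h F≗h hs (inj₁ x→y) with unitStep-image F h F≗h hs x→y
... | inj₁ up   = inj₁ (inj₁ (sym up))
... | inj₂ flat = inj₂ (toℕ-injective (sym flat))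
unitStep-contraction F h F≗h hs (inj₂ y→x) with unitStep-image F h F≗h hs y→x
... | inj₁ up   = inj₁ (inj₂ (sym up))
... | inj₂ flat = inj₂ (toℕ-injective flat)

path-step : ∀ {m} {x y : Fin (suc m)} → E (PathGraph m) x y ⊎ x ≡ y → toℕ y ≤ suc (toℕ x)
path-step (inj₁ (inj₁ x→y)) = ≤-reflexive (sym x→y)
path-step (inj₁ (inj₂ y→x)) = ≤-trans (n≤1+n _) (≤-trans (≤-reflexive y→x) (n≤1+n _))
path-step (inj₂ refl)       = n≤1+n _

shift : (a : ℕ) {m' m : ℕ} → a + m' ≤ m → Fin (suc m') → Fin (suc m)
shift a {m'} {m} fits x =
  fromℕ< (s≤s (≤-trans (+-monoˡ-≤ a (toℕ≤pred[n] x)) (subst (_≤ m) (+-comm a m') fits)))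

toℕ-shift : ∀ a {m' m} (fits : a + m' ≤ m) x → toℕ (shift a fits x) ≡ toℕ x + a
toℕ-shift a fits x = toℕ-fromℕ< _

shift-homomorphism : ∀ a {m' m} (fits : a + m' ≤ m) →
  Homomorphism (PathGraph m') (PathGraph m) (shift a fits)
shift-homomorphism a fits (inj₁ x→y) = inj₁ (shift-step x→y)
  where
  shift-step : ∀ {x y} → suc (toℕ x) ≡ toℕ y → suc (toℕ (shift a fits x)) ≡ toℕ (shift a fits y)
  shift-step {x} {y} p = trans (cong suc (toℕ-shift a fits x)) (trans (cong (_+ a) p) (sym (toℕ-shift a fits y)))
shift-homomorphism a fits (inj₂ y→x) with shift-homomorphism a fits (inj₁ y→x)
... | inj₁ e = inj₂ e
... | inj₂ e = inj₁ e

clamp : (a m' : ℕ) {m : ℕ} → Fin (suc m) → Fin (suc m')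
clamp a m' c = fromℕ< (s≤s (m⊓n≤n (toℕ c ∸ a) m'))

toℕ-clamp : ∀ a m' {m} (c : Fin (suc m)) → toℕ (clamp a m' c) ≡ (toℕ c ∸ a) ⊓ m'
toℕ-clamp a m' c = toℕ-fromℕ< _

clamp-contraction : ∀ a m' {m} → Contraction (PathGraph m) (PathGraph m') (clamp a m')
clamp-contraction a m' = unitStep-contraction (clamp a m') (λ c → (c ∸ a) ⊓ m')
  (toℕ-clamp a m') (unitStep-∘ (⊓-unitStep m') (∸-unitStep a))

clamp-at : ∀ a {m' m} (c : Fin (suc m)) (u : Fin (suc m')) → toℕ c ≡ toℕ u + a → clamp a m' c ≡ u
clamp-at a {m'} c u c≡u+a = toℕ-injective (begin
  toℕ (clamp a m' c)   ≡⟨ toℕ-clamp a m' c ⟩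
  (toℕ c ∸ a) ⊓ m'     ≡⟨ cong (λ t → (t ∸ a) ⊓ m') c≡u+a ⟩
  (toℕ u + a ∸ a) ⊓ m' ≡⟨ cong (_⊓ m') (m+n∸n≡m (toℕ u) a) ⟩
  toℕ u ⊓ m'           ≡⟨ m≤n⇒m⊓n≡m (toℕ≤pred[n] u) ⟩
  toℕ u                ∎)
  where open ≡-Reasoning

clamp-shift : ∀ a {m' m} (fits : a + m' ≤ m) x → clamp a m' (shift a fits x) ≡ x
clamp-shift a fits x = clamp-at a (shift a fits x) x (toℕ-shift a fits x)

shift-clamp : ∀ a {m' m} (fits : a + m' ≤ m) (c : Fin (suc m)) →
  a ≤ toℕ c → toℕ c ≤ a + m' → shift a fits (clamp a m' c) ≡ c
shift-clamp a {m'} fits c a≤c c≤a+m' = toℕ-injective (begin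
  toℕ (shift a fits (clamp a m' c)) ≡⟨ toℕ-shift a fits (clamp a m' c) ⟩
  toℕ (clamp a m' c) + a            ≡⟨ cong (_+ a) (toℕ-clamp a m' c) ⟩
  (toℕ c ∸ a) ⊓ m' + a              ≡⟨ cong (_+ a) (m≤n⇒m⊓n≡m (m≤n+o⇒m∸n≤o (toℕ c) a c≤a+m')) ⟩
  toℕ c ∸ a + a                     ≡⟨ m∸n+n≡m a≤c ⟩
  toℕ c                             ∎)
  where open ≡-Reasoning

mapL : (k : ℕ) {m m' : Fin k → ℕ} → (∀ j → Fin (suc (m j)) → Fin (suc (m' j))) →
  V (Lattice k m) → V (Lattice k m')
mapL zero            f x       = tt
mapL (suc k) {m} {m'} f (x , r) = f fz x , mapL k {tail m} {tail m'} (λ j → f (fs j)) r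

proj-mapL : ∀ k {m m'} (f : ∀ j → Fin (suc (m j)) → Fin (suc (m' j))) j x →
  proj k m' j (mapL k f x) ≡ f j (proj k m j x)
proj-mapL (suc k)           f fz     (x , r) = refl
proj-mapL (suc k) {m} {m'} f (fs j) (x , r) = proj-mapL k {tail m} {tail m'} (λ i → f (fs i)) j r

proj-injective : ∀ k {m} {x y : V (Lattice k m)} → (∀ j → proj k m j x ≡ proj k m j y) → x ≡ y
proj-injective zero    same = refl
proj-injective (suc k) same = cong₂ _,_ (same fz) (proj-injective k (λ j → same (fs j)))

mapL-homomorphism : ∀ k {m m'} (f : ∀ j → Fin (suc (m j)) → Fin (suc (m' j))) →
  (∀ j → Homomorphism (PathGraph (m j)) (PathGraph (m' j)) (f j)) →
  Homomorphism (Lattice k m) (Lattice k m') (mapL k f)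
mapL-homomorphism zero f hf ()
mapL-homomorphism (suc k) {m} {m'} f hf =
  homomorphism-□ {PathGraph (m fz)} {PathGraph (m' fz)} {Lattice k (tail m)} {Lattice k (tail m')}
    (hf fz) (mapL-homomorphism k (λ j → f (fs j)) (λ j → hf (fs j)))

mapL-contraction : ∀ k {m m'} (f : ∀ j → Fin (suc (m j)) → Fin (suc (m' j))) →
  (∀ j → Contraction (PathGraph (m j)) (PathGraph (m' j)) (f j)) →
  Contraction (Lattice k m) (Lattice k m') (mapL k f)
mapL-contraction zero f cf ()
mapL-contraction (suc k) {m} {m'} f cf =
  contraction-□ {PathGraph (m fz)} {PathGraph (m' fz)} {Lattice k (tail m)} {Lattice k (tail m')}
    (cf fz) (mapL-contraction k (λ j → f (fs j)) (λ j → cf (fs j)))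

proj-contraction : ∀ k m j → Contraction (Lattice k m) (PathGraph (m j)) (proj k m j)
proj-contraction (suc k) m fz     (inj₁ (e , _)) = inj₁ e
proj-contraction (suc k) m fz     (inj₂ (q , _)) = inj₂ q
proj-contraction (suc k) m (fs j) (inj₁ (_ , q)) = inj₂ (cong (proj k (tail m) j) q)
proj-contraction (suc k) m (fs j) (inj₂ (_ , e)) = proj-contraction k (tail m) j e

module Tighten (M : Graph) (connected : Connected M) (x₀ : V M)
  (vertices : List (V M)) (complete : ∀ x → x ∈ vertices)
  (k : ℕ) (m : Fin k → ℕ) (φ : V M → V (Lattice k m))
  (φ-iso : IsIsometricEmbedding M (Lattice k m) φ) where

  private module Extrema = Data.List.Extrema ≤-totalOrder

  coord : Fin k → V M → ℕ
  coord j x = toℕ (proj k m j (φ x))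

  lowest highest : Fin k → V M
  lowest  j = Extrema.argmin (coord j) x₀ vertices
  highest j = Extrema.argmax (coord j) x₀ vertices

  a m' : Fin k → ℕ
  a  j = coord j (lowest j)
  m' j = coord j (highest j) ∸ a j

  a≤coord : ∀ j x → a j ≤ coord j x
  a≤coord j x = lookup (Extrema.f[argmin]≤f[xs] {f = coord j} x₀ vertices) (complete x)

  coord≤highest : ∀ j x → coord j x ≤ coord j (highest j)
  coord≤highest j x = lookup (Extrema.f[xs]≤f[argmax] {f = coord j} x₀ vertices) (complete x)

  top : ∀ j → a j + m' j ≡ coord j (highest j)
  top j = m+[n∸m]≡n (≤-trans (a≤coord j x₀) (coord≤highest j x₀))

  coord≤top : ∀ j x → coord j x ≤ a j + m' j
  coord≤top j x = subst (coord j x ≤_) (sym (top j)) (coord≤highest j x)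

  window-fits : ∀ j → a j + m' j ≤ m j
  window-fits j = subst (_≤ m j) (sym (top j)) (toℕ≤pred[n] (proj k m j (φ (highest j))))

  ι : V (Lattice k m') → V (Lattice k m)
  ι = mapL k (λ j → shift (a j) (window-fits j))

  clampL : V (Lattice k m) → V (Lattice k m')
  clampL = mapL k (λ j → clamp (a j) (m' j))

  ψ : V M → V (Lattice k m')
  ψ x = clampL (φ x)

  clampL-ι : ∀ y → clampL (ι y) ≡ y
  clampL-ι y = proj-injective k λ j → begin
    proj k m' j (clampL (ι y))
      ≡⟨ proj-mapL k _ j (ι y) ⟩
    clamp (a j) (m' j) (proj k m j (ι y))
      ≡⟨ cong (clamp (a j) (m' j)) (proj-mapL k _ j y) ⟩
    clamp (a j) (m' j) (shift (a j) (window-fits j) (proj k m' j y))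
      ≡⟨ clamp-shift (a j) (window-fits j) _ ⟩
    proj k m' j y ∎
    where open ≡-Reasoning

  -- φ lands in the window, so shifting back the clamped image recovers φ.
  ι-ψ : ∀ x → ι (ψ x) ≡ φ x
  ι-ψ x = proj-injective k λ j → begin
    proj k m j (ι (ψ x))
      ≡⟨ proj-mapL k _ j (ψ x) ⟩
    shift (a j) (window-fits j) (proj k m' j (ψ x))
      ≡⟨ cong (shift (a j) (window-fits j)) (proj-mapL k _ j (φ x)) ⟩
    shift (a j) (window-fits j) (clamp (a j) (m' j) (proj k m j (φ x)))
      ≡⟨ shift-clamp (a j) (window-fits j) _ (a≤coord j x) (coord≤top j x) ⟩
    proj k m j (φ x) ∎
    where open ≡-Reasoning

  ι-isometric : IsIsometricEmbedding (Lattice k m') (Lattice k m) ι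
  ι-isometric = retract-isometric
    (mapL-homomorphism k _ (λ j → shift-homomorphism (a j) (window-fits j)))
    (mapL-contraction k _ (λ j → clamp-contraction (a j) (m' j)))
    clampL-ι

  ψ-isometric : IsIsometricEmbedding M (Lattice k m') ψ
  ψ-isometric = isometric-factor ψ ι φ ι-isometric φ-iso ι-ψ

  coord-step : ∀ j {u v} → E M u v → coord j v ≤ suc (coord j u)
  coord-step j e = path-step (proj-contraction k m j (isometric-homomorphism φ-iso e))

  -- Every position u of the j-th factor of the small lattice is attained:
  -- the value u + a j lies between the extreme coordinates.
  ψ-onto : ∀ j (u : Fin (suc (m' j))) → Σ (V M) λ x → proj k m' j (ψ x) ≡ u
  ψ-onto j u with intermediate-value (coord j) (coord-step j)
                    (proj₂ (connected (lowest j) (highest j))) (toℕ u + a j)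
                    (m≤n+m (a j) (toℕ u)) u+a≤highest
    where
    u+a≤highest : toℕ u + a j ≤ coord j (highest j)
    u+a≤highest = subst (toℕ u + a j ≤_) (trans (+-comm (m' j) (a j)) (top j))
                    (+-monoˡ-≤ (a j) (toℕ≤pred[n] u))
  ... | z , coord≡u+a = z , trans (proj-mapL k _ j (φ z)) (clamp-at (a j) (proj k m j (φ z)) u coord≡u+a)

enumerate : ∀ {M} → IsFinite M → Σ (List (V M)) λ vs → ∀ x → x ∈ vs
enumerate {M} (n , bij) = vs , complete
  where
  open Inverse bij
  vs : List (V M)
  vs = map from (allFin n)
  complete : ∀ x → x ∈ vs
  complete x = subst (_∈ vs) (strictlyInverseʳ x) (∈-map⁺ from (∈-allFin (to x)))

vertexless-embeds : ∀ {M} → (V M → ⊥) → EmbedsInLattice M 0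
vertexless-embeds none = (λ ()) , (λ x → ⊥-elim (none x)) , (λ u → ⊥-elim (none u))

-- Lemma 3.6.  With k = 0 there is nothing to tighten; otherwise M is
-- nonempty (else it would embed in the 0-lattice, contradicting minimality
-- of k), and tightening any optimal embedding gives the claim.
lemma3p6 : (M : Graph) → IsFinite M → IsMedian M → (k : ℕ) → IsLatticeDimension M k →
    Σ (Fin k → ℕ) λ m → Σ (V M → V (Lattice k m)) λ φ →
    IsIsometricEmbedding M (Lattice k m) φ ×
    (∀ (j : Fin k) (u : Fin (suc (m j))) → Σ (V M) λ x → proj k m j (φ x) ≡ u)
lemma3p6 M finite median zero    ((m , φ , φ-iso) , _) = m , φ , φ-iso , λ ()
lemma3p6 M finite median (suc k) ((m , φ , φ-iso) , minimal) with enumerate {M} finite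
... | [] , complete =
  ⊥-elim (n≮0 (minimal 0 (vertexless-embeds (λ x → ¬Any[] (complete x)))))
... | x₀ ∷ xs , complete = m' , ψ , ψ-isometric , ψ-onto
  where open Tighten M (proj₁ median) x₀ (x₀ ∷ xs) complete (suc k) m φ φ-iso
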